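{- Let $P$ be a poset with $\operatorname{iir}(P) = |P|$ and let $\mathcal{S}=\{S_x: x\in P\}$ be an irreducible inclusion representation of $P$ with $|\bigcup\mathcal{S}|=|P|$. Then, $\mathcal{S}$ is isomorphic to the canonical inclusion representation $\{D_P[x]:x\in P\}$ of $P$.
   Context: All posets are finite with non-empty ground sets. An inclusion representation of $P$ is a family $\{S_x:x\in P\}$ with $x\le y$ iff $S_x\subseteq S_y$; $D_P[x]=\{u\in P:u\le x\}$. Two inclusion representations $\mathcal{S},\mathcal{S}'$ of $P$ are isomorphic if there is a bijection $f:\bigcup\mathcal{S}\to\bigcup\mathcal{S}'$ with $a\in S_x$ iff $f(a)\in S'_x$. $\mathcal{S}$ is a reduction of $\mathcal{S}'$ if $|\bigcup\mathcal{S}|\le|\bigcup\mathcal{S}'|$ and $|S_x|\le|S'_x|$ for all $x$; a strict reduction if additionally $\mathcal{S}'$ is not a reduction of $\mathcal{S}$; irreducible if it has no strict reduction. $\operatorname{iir}(P)$ is the maximum ground-set size of an irreducible inclusion representation of $P$. -}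

module Defs where

open import Data.Nat using (ℕ; suc; _≤_)
open import Data.Bool using (Bool; true)
open import Data.Fin using (Fin)
open import Data.Fin.Subset using (Subset; _∈_; _⊆_; ⋃; ∣_∣)
open import Data.List using (allFin) renaming (map to lmap)
open import Data.Vec using (tabulate)
open import Data.Product using (Σ; _×_; ∃)
open import Relation.Nullary using (¬_)
open import Relation.Binary.PropositionalEquality using (_≡_)

record FinPoset (n : ℕ) : Set where
  field
    leq     : Fin (suc n) → Fin (suc n) → Bool
    refl    : ∀ x → leq x x ≡ true
    antisym : ∀ x y → leq x y ≡ true → leq y x ≡ true → x ≡ y
    trans   : ∀ x y z → leq x y ≡ true → leq y z ≡ true → leq x z ≡ true

open FinPoset public

-- A family of sets {S_x : x ∈ P}, each a subset of an ambient finite set Fin m.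
-- Only the union of the family (the ground set) matters.
Family : ℕ → ℕ → Set
Family n m = Fin (suc n) → Subset m

Union : ∀ {n m} → Family n m → Subset m
Union {n} S = ⋃ (lmap S (allFin (suc n)))

groundSize : ∀ {n m} → Family n m → ℕ
groundSize S = ∣ Union S ∣

IsInclRep : ∀ {n m} → FinPoset n → Family n m → Set
IsInclRep P S = ∀ x y → (leq P x y ≡ true → S x ⊆ S y) × (S x ⊆ S y → leq P x y ≡ true)

IsReduction : ∀ {n m m'} → Family n m → Family n m' → Set
IsReduction S S' = (groundSize S ≤ groundSize S') × (∀ x → ∣ S x ∣ ≤ ∣ S' x ∣)

IsStrictReduction : ∀ {n m m'} → Family n m → Family n m' → Set
IsStrictReduction S S' = IsReduction S S' × ¬ IsReduction S' S

IsIrreducible : ∀ {n m} → FinPoset n → Family n m → Set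
IsIrreducible {n} P S =
  IsInclRep P S ×
  ((m' : ℕ) (S' : Family n m') → IsInclRep P S' → ¬ IsStrictReduction S' S)

IsIIR : ∀ {n} → FinPoset n → ℕ → Set
IsIIR {n} P k =
  (Σ ℕ λ m → Σ (Family n m) λ S → IsIrreducible P S × groundSize S ≡ k) ×
  ((m : ℕ) (S : Family n m) → IsIrreducible P S → groundSize S ≤ k)

Down : ∀ {n} → FinPoset n → Family n (suc n)
Down P x = tabulate (λ u → leq P u x)

Isomorphic : ∀ {n m m'} → Family n m → Family n m' → Set
Isomorphic {n} {m} {m'} S S' =
  Σ (Fin m → Fin m') λ f → Σ (Fin m' → Fin m) λ g →
    (∀ a → a ∈ Union S → f a ∈ Union S') ×
    (∀ b → b ∈ Union S' → g b ∈ Union S) ×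
    (∀ a → a ∈ Union S → g (f a) ≡ a) ×
    (∀ b → b ∈ Union S' → f (g b) ≡ b) ×
    (∀ a x → a ∈ Union S → (a ∈ S x → f a ∈ S' x) × (f a ∈ S' x → a ∈ S x))

module Submission where

-- Write N(Y) for the union of the S p with p ∈ Y. Maximise the deficiency |Y| − |N(Y)| at some X
-- and splice S with the down-sets: x ↦ (S x ∩ N(X)) ⊎ (D[x] ∖ X). This is again an inclusion
-- representation, and maximality of X makes it a reduction of S. By irreducibility S is a
-- reduction of it as well. For X of maximal deficiency this gives Hall's condition |Y| ≤ |N(Y)|,
-- and for X = ∅ it gives |S x| ≤ |D[x]|. Every point a is fresh at a minimal p with a ∈ S p,
-- meaning that a lies in no S w with w < p. Hall's condition at D[p] ∖ {p} and |S p| ≤ |D[p]|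
-- allow only one fresh point per p. So a ↦ p is injective, hence bijective because the ground
-- set has |P| points, and a counting argument then identifies S x with the image of D[x].

open import Defs hiding (refl; trans; antisym)

open import Data.Bool.Base using (true)
open import Data.List.Base using (List; []; _∷_; allFin) renaming (map to mapₗ)
open import Data.List.Membership.Propositional using (lose)
open import Data.List.Membership.Propositional.Properties using (∈-allFin)
open import Data.List.Relation.Unary.Any using (Any; here; there; satisfied)
open import Data.List.Relation.Unary.Any.Properties using (map⁺; map⁻)
open import Data.Fin.Base using (Fin; zero; suc; _↑ˡ_; _↑ʳ_)
open import Data.Fin.Properties using (any?; all?; suc-injective; 0≢1+n; _≟_)
open import Data.Fin.Subset
open import Data.Fin.Subset.Properties
open import Data.Nat.Base using (ℕ; zero; suc; _+_; _∸_; _≤_; _<_; z≤n; s≤s)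
open import Data.Nat.Properties hiding (suc-injective; 0≢1+n; _≟_)
open import Data.Product using (∃; _×_; _,_; proj₁; proj₂; ∃-syntax)
open import Data.Sum.Base using (inj₁; inj₂)
open import Data.Vec.Base using ([]; _∷_; _++_; here; there)
open import Data.Vec.Properties using (lookup⇒[]=; []=⇒lookup; lookup∘tabulate)
open import Function.Base using (_∘_)
open import Relation.Binary.PropositionalEquality using (_≡_; _≢_; refl; sym; trans; cong; cong₂; subst; module ≡-Reasoning)
open import Relation.Nullary using (Dec; yes; no; contradiction)
open import Relation.Nullary.Decidable using (_×-dec_; decidable-stable)
open import Relation.Unary using (Pred; Decidable)

private
  variable
    k l : ℕ

∣p∪q∣+∣p∩q∣≡∣p∣+∣q∣ : (p q : Subset k) → ∣ p ∪ q ∣ + ∣ p ∩ q ∣ ≡ ∣ p ∣ + ∣ q ∣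
∣p∪q∣+∣p∩q∣≡∣p∣+∣q∣ []            []            = refl
∣p∪q∣+∣p∩q∣≡∣p∣+∣q∣ (inside ∷ p)  (inside ∷ q)  =
  cong suc (trans (+-suc _ _) (trans (cong suc (∣p∪q∣+∣p∩q∣≡∣p∣+∣q∣ p q)) (sym (+-suc _ _))))
∣p∪q∣+∣p∩q∣≡∣p∣+∣q∣ (inside ∷ p)  (outside ∷ q) = cong suc (∣p∪q∣+∣p∩q∣≡∣p∣+∣q∣ p q)
∣p∪q∣+∣p∩q∣≡∣p∣+∣q∣ (outside ∷ p) (inside ∷ q)  =
  trans (cong suc (∣p∪q∣+∣p∩q∣≡∣p∣+∣q∣ p q)) (sym (+-suc _ _))
∣p∪q∣+∣p∩q∣≡∣p∣+∣q∣ (outside ∷ p) (outside ∷ q) = ∣p∪q∣+∣p∩q∣≡∣p∣+∣q∣ p q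

∣p∪q∣≤∣p∣+∣q∣ : (p q : Subset k) → ∣ p ∪ q ∣ ≤ ∣ p ∣ + ∣ q ∣
∣p∪q∣≤∣p∣+∣q∣ p q = ≤-trans (m≤m+n _ _) (≤-reflexive (∣p∪q∣+∣p∩q∣≡∣p∣+∣q∣ p q))

q⊆∁p⇒∣p∪q∣≡∣p∣+∣q∣ : {p q : Subset k} → q ⊆ ∁ p → ∣ p ∪ q ∣ ≡ ∣ p ∣ + ∣ q ∣
q⊆∁p⇒∣p∪q∣≡∣p∣+∣q∣ {k} {p} {q} q⊆∁p = begin
  ∣ p ∪ q ∣                ≡⟨ +-identityʳ _ ⟨
  ∣ p ∪ q ∣ + 0            ≡⟨ cong (∣ p ∪ q ∣ +_) (∣⊥∣≡0 k) ⟨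
  ∣ p ∪ q ∣ + ∣ ⊥ {k} ∣    ≡⟨ cong (λ r → ∣ p ∪ q ∣ + ∣ r ∣) (Empty-unique disjoint) ⟨
  ∣ p ∪ q ∣ + ∣ p ∩ q ∣    ≡⟨ ∣p∪q∣+∣p∩q∣≡∣p∣+∣q∣ p q ⟩
  ∣ p ∣ + ∣ q ∣            ∎
  where
  open ≡-Reasoning
  disjoint : Empty (p ∩ q)
  disjoint (x , x∈p∩q) = let x∈p , x∈q = x∈p∩q⁻ p q x∈p∩q in x∈∁p⇒x∉p (q⊆∁p x∈q) x∈p

∣p∣≡∣p∩q∣+∣p─q∣ : (p q : Subset k) → ∣ p ∣ ≡ ∣ p ∩ q ∣ + ∣ p ─ q ∣
∣p∣≡∣p∩q∣+∣p─q∣ []            []            = refl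
∣p∣≡∣p∩q∣+∣p─q∣ (inside ∷ p)  (inside ∷ q)  = cong suc (∣p∣≡∣p∩q∣+∣p─q∣ p q)
∣p∣≡∣p∩q∣+∣p─q∣ (inside ∷ p)  (outside ∷ q) = trans (cong suc (∣p∣≡∣p∩q∣+∣p─q∣ p q)) (sym (+-suc _ _))
∣p∣≡∣p∩q∣+∣p─q∣ (outside ∷ p) (inside ∷ q)  = ∣p∣≡∣p∩q∣+∣p─q∣ p q
∣p∣≡∣p∩q∣+∣p─q∣ (outside ∷ p) (outside ∷ q) = ∣p∣≡∣p∩q∣+∣p─q∣ p q

∣p∣+∣∁p∣≡n : (p : Subset k) → ∣ p ∣ + ∣ ∁ p ∣ ≡ k
∣p∣+∣∁p∣≡n p = trans (cong (∣ p ∣ +_) (∣∁p∣≡n∸∣p∣ p)) (m+[n∸m]≡n (∣p∣≤n p))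

∣p∣≤1+∣p-x∣ : (p : Subset k) (x : Fin k) → ∣ p ∣ ≤ 1 + ∣ p - x ∣
∣p∣≤1+∣p-x∣ p x = begin
  ∣ p ∣                       ≡⟨ ∣p∣≡∣p∩q∣+∣p─q∣ p ⁅ x ⁆ ⟩
  ∣ p ∩ ⁅ x ⁆ ∣ + ∣ p - x ∣   ≤⟨ +-monoˡ-≤ _ (∣p∩q∣≤∣q∣ p ⁅ x ⁆) ⟩
  ∣ ⁅ x ⁆ ∣ + ∣ p - x ∣       ≡⟨ cong (_+ ∣ p - x ∣) (∣⁅x⁆∣≡1 x) ⟩
  1 + ∣ p - x ∣               ∎
  where open ≤-Reasoning

p⊆q∧∣q∣≤∣p∣⇒q⊆p : {p q : Subset k} → p ⊆ q → ∣ q ∣ ≤ ∣ p ∣ → q ⊆ p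
p⊆q∧∣q∣≤∣p∣⇒q⊆p {p = p} p⊆q ∣q∣≤∣p∣ {x} x∈q with x ∈? p
... | yes x∈p = x∈p
... | no  x∉p = contradiction ∣q∣≤∣p∣ (<⇒≱ (p⊂q⇒∣p∣<∣q∣ (p⊆q , x , x∈q , x∉p)))

x∈p─q⇒x∉q : {p q : Subset k} {x : Fin k} → x ∈ p ─ q → x ∉ q
x∈p─q⇒x∉q {p = _ ∷ p} {outside ∷ q} (there x∈) (there x∈q) = x∈p─q⇒x∉q {p = p} x∈ x∈q
x∈p─q⇒x∉q {p = _ ∷ p} {inside ∷ q}  (there x∈) (there x∈q) = x∈p─q⇒x∉q {p = p} x∈ x∈q

x∈p-y⇒x≢y : {p : Subset k} {x y : Fin k} → x ∈ p - y → x ≢ y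
x∈p-y⇒x≢y {x = x} x∈ refl = x∈p─q⇒x∉q x∈ (x∈⁅x⁆ x)

p─q⊆∁q : {p q : Subset k} → p ─ q ⊆ ∁ q
p─q⊆∁q x∈ = x∉p⇒x∈∁p (x∈p─q⇒x∉q x∈)

─-monoˡ-⊆ : {p q r : Subset k} → p ⊆ q → p ─ r ⊆ q ─ r
─-monoˡ-⊆ {p = p} {r = r} p⊆q x∈ = x∈p∧x∉q⇒x∈p─q (p⊆q (p─q⊆p p r x∈)) (x∈p─q⇒x∉q x∈)

∩-monoˡ-⊆ : {p q r : Subset k} → p ⊆ q → p ∩ r ⊆ q ∩ r
∩-monoˡ-⊆ {p = p} {r = r} p⊆q x∈ = let x∈p , x∈r = x∈p∩q⁻ p r x∈ in x∈p∩q⁺ (p⊆q x∈p , x∈r)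

∣p++q∣≡∣p∣+∣q∣ : (p : Subset k) (q : Subset l) → ∣ p ++ q ∣ ≡ ∣ p ∣ + ∣ q ∣
∣p++q∣≡∣p∣+∣q∣ []            q = refl
∣p++q∣≡∣p∣+∣q∣ (inside ∷ p)  q = cong suc (∣p++q∣≡∣p∣+∣q∣ p q)
∣p++q∣≡∣p∣+∣q∣ (outside ∷ p) q = ∣p++q∣≡∣p∣+∣q∣ p q

++⁺-⊆ : {p r : Subset k} {q s : Subset l} → p ⊆ r → q ⊆ s → p ++ q ⊆ r ++ s
++⁺-⊆ {p = []}    {[]}    _   q⊆s x∈         = q⊆s x∈
++⁺-⊆ {p = _ ∷ _} {_ ∷ _} p⊆r _   here       with p⊆r here
... | here = here
++⁺-⊆ {p = _ ∷ _} {_ ∷ _} p⊆r q⊆s (there x∈) = there (++⁺-⊆ (drop-∷-⊆ p⊆r) q⊆s x∈)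

x∈p++q⁻ˡ : {p : Subset k} {q : Subset l} {x : Fin k} → x ↑ˡ l ∈ p ++ q → x ∈ p
x∈p++q⁻ˡ {p = _ ∷ _} {x = zero}  here       = here
x∈p++q⁻ˡ {p = _ ∷ _} {x = suc x} (there x∈) = there (x∈p++q⁻ˡ x∈)

x∈p++q⁺ˡ : {p : Subset k} {q : Subset l} {x : Fin k} → x ∈ p → x ↑ˡ l ∈ p ++ q
x∈p++q⁺ˡ here       = here
x∈p++q⁺ˡ (there x∈) = there (x∈p++q⁺ˡ x∈)

x∈p++q⁻ʳ : (p : Subset k) {q : Subset l} {y : Fin l} → k ↑ʳ y ∈ p ++ q → y ∈ q
x∈p++q⁻ʳ []      y∈         = y∈
x∈p++q⁻ʳ (_ ∷ p) (there y∈) = x∈p++q⁻ʳ p y∈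

x∈p++q⁺ʳ : (p : Subset k) {q : Subset l} {y : Fin l} → y ∈ q → k ↑ʳ y ∈ p ++ q
x∈p++q⁺ʳ []      y∈ = y∈
x∈p++q⁺ʳ (_ ∷ p) y∈ = there (x∈p++q⁺ʳ p y∈)

argmax : (e : Subset k → ℕ) → ∃[ X ] (∀ Y → e Y ≤ e X)
argmax {zero}  e = [] , λ { [] → ≤-refl }
argmax {suc k} e with argmax (e ∘ (outside ∷_)) | argmax (e ∘ (inside ∷_))
... | X₀ , max₀ | X₁ , max₁ with e (outside ∷ X₀) ≤? e (inside ∷ X₁)
... | yes ≤₁ = inside ∷ X₁ , λ { (outside ∷ Y) → ≤-trans (max₀ Y) ≤₁ ; (inside ∷ Y) → max₁ Y }
... | no  ≰₁ = outside ∷ X₀ , λ { (outside ∷ Y) → max₀ Y ; (inside ∷ Y) → ≤-trans (max₁ Y) (≰⇒≥ ≰₁) }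

argmin : ∀ {ℓ} {Q : Pred (Fin (suc k)) ℓ} → Decidable Q → (μ : Fin (suc k) → ℕ) →
         ∃[ j ] (∀ {i} → Q i → Q j × μ j ≤ μ i)
argmin {Q = Q} Q? μ with any? Q?
... | no  ∄Q       = zero , λ Qi → contradiction (_ , Qi) ∄Q
... | yes (i , Qi) = let j , Qj , min = descend (suc (μ i)) ≤-refl Qi in j , λ Qi' → Qj , min Qi'
  where
  descend : ∀ b {i} → μ i < b → Q i → ∃[ j ] Q j × (∀ {i} → Q i → μ j ≤ μ i)
  descend (suc b) {i} μi<b Qi with any? (λ j → Q? j ×-dec μ j <? μ i)
  ... | no  ∄smaller      = i , Qi , λ Qi' → ≮⇒≥ (λ μi'<μi → ∄smaller (_ , Qi' , μi'<μi))
  ... | yes (j , Qj , μj<μi) = descend b (<-≤-trans μj<μi (≤-pred μi<b)) Qj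

infix 8 ⋃[_]_

⋃[_]_ : ∀ {m} → Subset k → (Fin k → Subset m) → Subset m
⋃[ []          ] S = ⊥
⋃[ inside  ∷ Y ] S = S zero ∪ ⋃[ Y ] (S ∘ suc)
⋃[ outside ∷ Y ] S = ⋃[ Y ] (S ∘ suc)

module _ {m : ℕ} where

  x∈⋃[]⁺ : {Y : Subset k} (S : Fin k → Subset m) {p : Fin k} {a : Fin m} →
           p ∈ Y → a ∈ S p → a ∈ ⋃[ Y ] S
  x∈⋃[]⁺ {Y = inside ∷ Y}  S here       a∈ = x∈p∪q⁺ (inj₁ a∈)
  x∈⋃[]⁺ {Y = inside ∷ Y}  S (there p∈) a∈ = x∈p∪q⁺ (inj₂ (x∈⋃[]⁺ (S ∘ suc) p∈ a∈))
  x∈⋃[]⁺ {Y = outside ∷ Y} S (there p∈) a∈ = x∈⋃[]⁺ (S ∘ suc) p∈ a∈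

  x∈⋃[]⁻ : (Y : Subset k) (S : Fin k → Subset m) {a : Fin m} →
           a ∈ ⋃[ Y ] S → ∃[ p ] p ∈ Y × a ∈ S p
  x∈⋃[]⁻ []            S a∈ = contradiction a∈ ∉⊥
  x∈⋃[]⁻ (inside ∷ Y)  S a∈ with x∈p∪q⁻ (S zero) _ a∈
  ... | inj₁ a∈S₀ = zero , here , a∈S₀
  ... | inj₂ a∈   = let p , p∈Y , a∈Sp = x∈⋃[]⁻ Y (S ∘ suc) a∈ in suc p , there p∈Y , a∈Sp
  x∈⋃[]⁻ (outside ∷ Y) S a∈ = let p , p∈Y , a∈Sp = x∈⋃[]⁻ Y (S ∘ suc) a∈ in suc p , there p∈Y , a∈Sp

  ⋃[]-least : (Y : Subset k) (S : Fin k → Subset m) {T : Subset m} →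
              (∀ {p} → p ∈ Y → S p ⊆ T) → ⋃[ Y ] S ⊆ T
  ⋃[]-least Y S S⊆T a∈ = let p , p∈Y , a∈Sp = x∈⋃[]⁻ Y S a∈ in S⊆T p∈Y a∈Sp

  ⋃[⊥]≡⊥ : (S : Fin k → Subset m) → ⋃[ ⊥ ] S ≡ ⊥
  ⋃[⊥]≡⊥ {zero}  S = refl
  ⋃[⊥]≡⊥ {suc k} S = ⋃[⊥]≡⊥ (S ∘ suc)

  image : (Fin k → Fin m) → Subset k → Subset m
  image f A = ⋃[ A ] (⁅_⁆ ∘ f)

  x∈image⁻ : (f : Fin k → Fin m) (A : Subset k) {y : Fin m} → y ∈ image f A → ∃[ x ] x ∈ A × f x ≡ y
  x∈image⁻ f A y∈ = let x , x∈A , y∈⁅fx⁆ = x∈⋃[]⁻ A (⁅_⁆ ∘ f) y∈ in x , x∈A , sym (x∈⁅y⁆⇒x≡y _ y∈⁅fx⁆)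

  ∣p∣≤∣image∣ : (f : Fin k → Fin m) (A : Subset k) →
                (∀ {x y} → x ∈ A → y ∈ A → f x ≡ f y → x ≡ y) → ∣ A ∣ ≤ ∣ image f A ∣
  ∣p∣≤∣image∣ f []            inj = z≤n
  ∣p∣≤∣image∣ f (outside ∷ A) inj = ∣p∣≤∣image∣ (f ∘ suc) A λ x∈ y∈ → suc-injective ∘ inj (there x∈) (there y∈)
  ∣p∣≤∣image∣ f (inside ∷ A)  inj = ≤-trans
    (s≤s (∣p∣≤∣image∣ (f ∘ suc) A λ x∈ y∈ → suc-injective ∘ inj (there x∈) (there y∈)))
    (p⊂q⇒∣p∣<∣q∣ f₀-new)
    where
    f₀-new : image (f ∘ suc) A ⊂ ⁅ f zero ⁆ ∪ image (f ∘ suc) A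
    f₀-new = q⊆p∪q ⁅ f zero ⁆ _ , f zero , x∈p∪q⁺ (inj₁ (x∈⁅x⁆ _)) , λ f₀∈ →
      let x , x∈A , fx≡f₀ = x∈image⁻ (f ∘ suc) A f₀∈ in 0≢1+n (inj here (there x∈A) (sym fx≡f₀))

x∈⋃⁺ : {ps : List (Subset k)} {x : Fin k} → Any (x ∈_) ps → x ∈ ⋃ ps
x∈⋃⁺ (here x∈p)  = x∈p∪q⁺ (inj₁ x∈p)
x∈⋃⁺ (there x∈) = x∈p∪q⁺ (inj₂ (x∈⋃⁺ x∈))

x∈⋃⁻ : (ps : List (Subset k)) {x : Fin k} → x ∈ ⋃ ps → Any (x ∈_) ps
x∈⋃⁻ []       x∈ = contradiction x∈ ∉⊥
x∈⋃⁻ (p ∷ ps) x∈ with x∈p∪q⁻ p (⋃ ps) x∈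
... | inj₁ x∈p = here x∈p
... | inj₂ x∈  = there (x∈⋃⁻ ps x∈)

module _ {n m : ℕ} (S : Family n m) where

  x∈Union⁺ : ∀ {a x} → a ∈ S x → a ∈ Union S
  x∈Union⁺ {x = x} a∈ = x∈⋃⁺ (map⁺ (lose (∈-allFin x) a∈))

  x∈Union⁻ : ∀ {a} → a ∈ Union S → ∃[ x ] a ∈ S x
  x∈Union⁻ a∈ = satisfied (map⁻ (x∈⋃⁻ (mapₗ S (allFin (suc n))) a∈))

  Union-least : {T : Subset m} → (∀ x → S x ⊆ T) → Union S ⊆ T
  Union-least S⊆T a∈ = let x , a∈Sx = x∈Union⁻ a∈ in S⊆T x a∈Sx

module _ {m : ℕ} (S : Fin k → Subset m) where

  HallCondition : Set
  HallCondition = ∀ Y → ∣ Y ∣ ≤ ∣ ⋃[ Y ] S ∣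

  -- |Y| − |N(Y)| shifted by m, since |∁ N(Y)| = m − |N(Y)|; this keeps it in ℕ.
  deficiency : Subset k → ℕ
  deficiency Y = ∣ Y ∣ + ∣ ∁ (⋃[ Y ] S) ∣

  MaximalDeficiency : Subset k → Set
  MaximalDeficiency X = ∀ Y → deficiency Y ≤ deficiency X

  maximalDeficiency : ∃ MaximalDeficiency
  maximalDeficiency = argmax deficiency

  deficiency≤m : ∀ Y → ∣ Y ∣ ≤ ∣ ⋃[ Y ] S ∣ → deficiency Y ≤ m
  deficiency≤m Y ∣Y∣≤∣NY∣ = ≤-trans (+-monoˡ-≤ ∣ ∁ (⋃[ Y ] S) ∣ ∣Y∣≤∣NY∣) (≤-reflexive (∣p∣+∣∁p∣≡n (⋃[ Y ] S)))

  maximalDeficiency⇒hall : ∀ X → MaximalDeficiency X → ∣ X ∣ ≤ ∣ ⋃[ X ] S ∣ → HallCondition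
  maximalDeficiency⇒hall X max ∣X∣≤∣NX∣ Y = +-cancelʳ-≤ (∣ ∁ (⋃[ Y ] S) ∣) (∣ Y ∣) (∣ ⋃[ Y ] S ∣) (begin
    ∣ Y ∣ + ∣ ∁ (⋃[ Y ] S) ∣              ≤⟨ max Y ⟩
    deficiency X                          ≤⟨ deficiency≤m X ∣X∣≤∣NX∣ ⟩
    m                                     ≡⟨ ∣p∣+∣∁p∣≡n (⋃[ Y ] S) ⟨
    ∣ ⋃[ Y ] S ∣ + ∣ ∁ (⋃[ Y ] S) ∣       ∎)
    where open ≤-Reasoning

  deficiency[⊥]≡m : deficiency ⊥ ≡ m
  deficiency[⊥]≡m = begin
    ∣ ⊥ {k} ∣ + ∣ ∁ (⋃[ ⊥ ] S) ∣    ≡⟨ cong₂ (λ r N → r + ∣ ∁ N ∣) (∣⊥∣≡0 k) (⋃[⊥]≡⊥ S) ⟩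
    ∣ ∁ (⊥ {m}) ∣                  ≡⟨ ∣∁p∣≡n∸∣p∣ (⊥ {m}) ⟩
    m ∸ ∣ ⊥ {m} ∣                  ≡⟨ cong (m ∸_) (∣⊥∣≡0 m) ⟩
    m                              ∎
    where open ≡-Reasoning

  hall⇒maximalDeficiency⊥ : HallCondition → MaximalDeficiency ⊥
  hall⇒maximalDeficiency⊥ hall Y = ≤-trans (deficiency≤m Y (hall Y)) (≤-reflexive (sym deficiency[⊥]≡m))

  -- Compare X with X ∪ W: this adds |W| to |Y| and at most |N(W) ─ N(X)| to |N(Y)|.
  hall-outside : ∀ {X W} → MaximalDeficiency X → W ⊆ ∁ X → ∣ W ∣ ≤ ∣ ⋃[ W ] S ─ ⋃[ X ] S ∣
  hall-outside {X} {W} max W⊆∁X = +-cancelʳ-≤ (∣ ∁ NZ ∣) (∣ W ∣) (∣ D ∣) (+-cancelˡ-≤ (∣ X ∣) _ _ (begin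
    ∣ X ∣ + (∣ W ∣ + ∣ ∁ NZ ∣)     ≡⟨ +-assoc ∣ X ∣ _ _ ⟨
    (∣ X ∣ + ∣ W ∣) + ∣ ∁ NZ ∣     ≡⟨ cong (_+ ∣ ∁ NZ ∣) (q⊆∁p⇒∣p∪q∣≡∣p∣+∣q∣ W⊆∁X) ⟨
    deficiency (X ∪ W)             ≤⟨ max (X ∪ W) ⟩
    ∣ X ∣ + ∣ ∁ (⋃[ X ] S) ∣       ≤⟨ +-monoʳ-≤ ∣ X ∣ (≤-trans (p⊆q⇒∣p∣≤∣q∣ ∁NX⊆) (∣p∪q∣≤∣p∣+∣q∣ (∁ NZ) D)) ⟩
    ∣ X ∣ + (∣ ∁ NZ ∣ + ∣ D ∣)     ≡⟨ cong (∣ X ∣ +_) (+-comm _ ∣ D ∣) ⟩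
    ∣ X ∣ + (∣ D ∣ + ∣ ∁ NZ ∣)     ∎))
    where
    open ≤-Reasoning
    NZ = ⋃[ X ∪ W ] S
    D  = ⋃[ W ] S ─ ⋃[ X ] S
    ∁NX⊆ : ∁ (⋃[ X ] S) ⊆ ∁ NZ ∪ D
    ∁NX⊆ {a} a∈ with a ∈? NZ
    ... | no  a∉NZ = x∈p∪q⁺ (inj₁ (x∉p⇒x∈∁p a∉NZ))
    ... | yes a∈NZ with x∈⋃[]⁻ (X ∪ W) S a∈NZ
    ...   | p , p∈X∪W , a∈Sp with x∈p∪q⁻ X W p∈X∪W
    ...     | inj₁ p∈X = contradiction (x∈⋃[]⁺ S p∈X a∈Sp) (x∈∁p⇒x∉p a∈)
    ...     | inj₂ p∈W = x∈p∪q⁺ (inj₂ (x∈p∧x∉q⇒x∈p─q (x∈⋃[]⁺ S p∈W a∈Sp) (x∈∁p⇒x∉p a∈)))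

  ∣A∩N[X]∣+∣W∣≤∣A∣ : ∀ X W A → MaximalDeficiency X → W ⊆ ∁ X → ⋃[ W ] S ⊆ A →
                     ∣ A ∩ ⋃[ X ] S ∣ + ∣ W ∣ ≤ ∣ A ∣
  ∣A∩N[X]∣+∣W∣≤∣A∣ X W A max W⊆∁X N[W]⊆A = begin
    ∣ A ∩ ⋃[ X ] S ∣ + ∣ W ∣                    ≤⟨ +-monoʳ-≤ (∣ A ∩ ⋃[ X ] S ∣) (hall-outside max W⊆∁X) ⟩
    ∣ A ∩ ⋃[ X ] S ∣ + ∣ ⋃[ W ] S ─ ⋃[ X ] S ∣  ≤⟨ +-monoʳ-≤ (∣ A ∩ ⋃[ X ] S ∣) (p⊆q⇒∣p∣≤∣q∣ (─-monoˡ-⊆ {r = ⋃[ X ] S} N[W]⊆A)) ⟩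
    ∣ A ∩ ⋃[ X ] S ∣ + ∣ A ─ ⋃[ X ] S ∣         ≡⟨ ∣p∣≡∣p∩q∣+∣p─q∣ A (⋃[ X ] S) ⟨
    ∣ A ∣                                       ∎
    where open ≤-Reasoning

module _ {n : ℕ} (P : FinPoset n) where

  infix 4 _≼_

  _≼_ : Fin (suc n) → Fin (suc n) → Set
  x ≼ y = leq P x y ≡ true

  x∈Down⁺ : ∀ {u x} → u ≼ x → u ∈ Down P x
  x∈Down⁺ {u} {x} u≼x = lookup⇒[]= u (Down P x) (trans (lookup∘tabulate (λ v → leq P v x) u) u≼x)

  x∈Down⁻ : ∀ {u x} → u ∈ Down P x → u ≼ x
  x∈Down⁻ {u} {x} u∈ = trans (sym (lookup∘tabulate (λ v → leq P v x) u)) ([]=⇒lookup u∈)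

  x∈Down[x] : ∀ x → x ∈ Down P x
  x∈Down[x] x = x∈Down⁺ (FinPoset.refl P x)

  Down-mono : ∀ {x y} → x ≼ y → Down P x ⊆ Down P y
  Down-mono {x} {y} x≼y u∈ = x∈Down⁺ (FinPoset.trans P _ x y (x∈Down⁻ u∈) x≼y)

  ∣Down∣-strict : ∀ {w p} → w ∈ Down P p - p → ∣ Down P w ∣ < ∣ Down P p ∣
  ∣Down∣-strict {w} {p} w∈ = p⊂q⇒∣p∣<∣q∣ (Down-mono w≼p , p , x∈Down[x] p , p∉Down[w])
    where
    w≼p = x∈Down⁻ (p─q⊆p _ _ w∈)
    p∉Down[w] : p ∉ Down P w
    p∉Down[w] p∈ = x∈p-y⇒x≢y w∈ (FinPoset.antisym P w p w≼p (x∈Down⁻ p∈))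

  module Representation {m : ℕ} {S : Family n m} (rep : IsInclRep P S) where

    mono : ∀ {x y} → x ≼ y → S x ⊆ S y
    mono {x} {y} = proj₁ (rep x y)

    ⋃[]⊆ : ∀ {Y x} → Y ⊆ Down P x → ⋃[ Y ] S ⊆ S x
    ⋃[]⊆ {Y} Y⊆Down = ⋃[]-least Y S (λ p∈Y → mono (x∈Down⁻ (Y⊆Down p∈Y)))

    ⋃[]⊆Union : ∀ Y → ⋃[ Y ] S ⊆ Union S
    ⋃[]⊆Union Y = ⋃[]-least Y S (λ _ → x∈Union⁺ S)

    mixed : Subset (suc n) → Family n (m + suc n)
    mixed X x = (S x ∩ ⋃[ X ] S) ++ (Down P x ─ X)

    mixed-isInclRep : ∀ X → IsInclRep P (mixed X)
    mixed-isInclRep X x y = (λ x≼y → ++⁺-⊆ (∩-monoˡ-⊆ (mono x≼y)) (─-monoˡ-⊆ (Down-mono x≼y))) , reflect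
      where
      -- For x ∈ X all of S x survives in the first part; otherwise x itself lies in the second.
      reflect : mixed X x ⊆ mixed X y → x ≼ y
      reflect mx⊆my with x ∈? X
      ... | yes x∈X = proj₂ (rep x y) λ a∈Sx →
            proj₁ (x∈p∩q⁻ _ _ (x∈p++q⁻ˡ (mx⊆my (x∈p++q⁺ˡ (x∈p∩q⁺ (a∈Sx , x∈⋃[]⁺ S x∈X a∈Sx))))))
      ... | no  x∉X = x∈Down⁻ (p─q⊆p _ X
            (x∈p++q⁻ʳ (S y ∩ ⋃[ X ] S) (mx⊆my (x∈p++q⁺ʳ (S x ∩ ⋃[ X ] S) (x∈p∧x∉q⇒x∈p─q (x∈Down[x] x) x∉X)))))

    Union-mixed⊆ : ∀ X → Union (mixed X) ⊆ (Union S ∩ ⋃[ X ] S) ++ ∁ X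
    Union-mixed⊆ X = Union-least (mixed X) λ x → ++⁺-⊆ (∩-monoˡ-⊆ (x∈Union⁺ S)) (p─q⊆∁q {p = Down P x})

    mixed-isReduction : ∀ {X} → MaximalDeficiency S X → IsReduction (mixed X) S
    mixed-isReduction {X} max = ground , size
      where
      ground : groundSize (mixed X) ≤ groundSize S
      ground = begin
        ∣ Union (mixed X) ∣                         ≤⟨ p⊆q⇒∣p∣≤∣q∣ (Union-mixed⊆ X) ⟩
        ∣ (Union S ∩ ⋃[ X ] S) ++ ∁ X ∣             ≡⟨ ∣p++q∣≡∣p∣+∣q∣ (Union S ∩ ⋃[ X ] S) (∁ X) ⟩
        ∣ Union S ∩ ⋃[ X ] S ∣ + ∣ ∁ X ∣            ≤⟨ ∣A∩N[X]∣+∣W∣≤∣A∣ S X (∁ X) (Union S) max ⊆-refl (⋃[]⊆Union (∁ X)) ⟩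
        ∣ Union S ∣                                 ∎
        where open ≤-Reasoning
      size : ∀ x → ∣ mixed X x ∣ ≤ ∣ S x ∣
      size x = begin
        ∣ mixed X x ∣                               ≡⟨ ∣p++q∣≡∣p∣+∣q∣ (S x ∩ ⋃[ X ] S) (Down P x ─ X) ⟩
        ∣ S x ∩ ⋃[ X ] S ∣ + ∣ Down P x ─ X ∣       ≤⟨ ∣A∩N[X]∣+∣W∣≤∣A∣ S X (Down P x ─ X) (S x) max (p─q⊆∁q {p = Down P x}) (⋃[]⊆ (p─q⊆p _ X)) ⟩
        ∣ S x ∣                                     ∎
        where open ≤-Reasoning

  module Irreducible {m : ℕ} {S : Family n m} (irreducible : IsIrreducible P S) where

    open Representation (proj₁ irreducible)

    isReduction? : ∀ {m′} (S′ : Family n m′) → Dec (IsReduction S S′)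
    isReduction? S′ = (groundSize S ≤? groundSize S′) ×-dec all? (λ x → ∣ S x ∣ ≤? ∣ S′ x ∣)

    reduction-reverses : ∀ {m′} {S′ : Family n m′} → IsInclRep P S′ → IsReduction S′ S → IsReduction S S′
    reduction-reverses {m′} {S′} rep′ S′≤S =
      decidable-stable (isReduction? S′) (λ S≰S′ → proj₂ irreducible m′ S′ rep′ (S′≤S , S≰S′))

    hall : groundSize S ≡ suc n → HallCondition S
    hall gs = maximalDeficiency⇒hall S X max ∣X∣≤∣N[X]∣
      where
      X   = proj₁ (maximalDeficiency S)
      max = proj₂ (maximalDeficiency S)
      open ≤-Reasoning
      ∣X∣≤∣N[X]∣ : ∣ X ∣ ≤ ∣ ⋃[ X ] S ∣
      ∣X∣≤∣N[X]∣ = +-cancelʳ-≤ (∣ ∁ X ∣) (∣ X ∣) (∣ ⋃[ X ] S ∣) (begin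
        ∣ X ∣ + ∣ ∁ X ∣                    ≡⟨ ∣p∣+∣∁p∣≡n X ⟩
        suc n                              ≡⟨ gs ⟨
        ∣ Union S ∣                        ≤⟨ proj₁ (reduction-reverses (mixed-isInclRep X) (mixed-isReduction max)) ⟩
        ∣ Union (mixed X) ∣                ≤⟨ p⊆q⇒∣p∣≤∣q∣ (Union-mixed⊆ X) ⟩
        ∣ (Union S ∩ ⋃[ X ] S) ++ ∁ X ∣    ≡⟨ ∣p++q∣≡∣p∣+∣q∣ (Union S ∩ ⋃[ X ] S) (∁ X) ⟩
        ∣ Union S ∩ ⋃[ X ] S ∣ + ∣ ∁ X ∣   ≤⟨ +-monoˡ-≤ (∣ ∁ X ∣) (∣p∩q∣≤∣q∣ (Union S) (⋃[ X ] S)) ⟩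
        ∣ ⋃[ X ] S ∣ + ∣ ∁ X ∣             ∎)

    ∣S∣≤∣Down∣ : HallCondition S → ∀ x → ∣ S x ∣ ≤ ∣ Down P x ∣
    ∣S∣≤∣Down∣ hallS x = begin
      ∣ S x ∣                                ≤⟨ proj₂ S≤mixed[⊥] x ⟩
      ∣ mixed ⊥ x ∣                          ≡⟨ ∣p++q∣≡∣p∣+∣q∣ (S x ∩ ⋃[ ⊥ ] S) (Down P x ─ ⊥) ⟩
      ∣ S x ∩ ⋃[ ⊥ ] S ∣ + ∣ Down P x ─ ⊥ ∣  ≡⟨ cong₂ (λ N D → ∣ S x ∩ N ∣ + ∣ D ∣) (⋃[⊥]≡⊥ S) (p─⊥≡p (Down P x)) ⟩
      ∣ S x ∩ ⊥ ∣ + ∣ Down P x ∣             ≡⟨ cong (λ r → ∣ r ∣ + ∣ Down P x ∣) (∩-zeroʳ (S x)) ⟩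
      ∣ ⊥ {m} ∣ + ∣ Down P x ∣               ≡⟨ cong (_+ ∣ Down P x ∣) (∣⊥∣≡0 m) ⟩
      ∣ Down P x ∣                           ∎
      where
      open ≤-Reasoning
      S≤mixed[⊥] : IsReduction S (mixed ⊥)
      S≤mixed[⊥] = reduction-reverses (mixed-isInclRep ⊥) (mixed-isReduction (hall⇒maximalDeficiency⊥ S hallS))

  module Canonical {m : ℕ} {S : Family n m} (rep : IsInclRep P S) (hallS : HallCondition S)
                   (bounded : ∀ x → ∣ S x ∣ ≤ ∣ Down P x ∣) (gs : groundSize S ≡ suc n) where

    open Representation rep

    Fresh : Fin (suc n) → Fin m → Set
    Fresh p a = a ∈ S p × a ∉ ⋃[ Down P p - p ] S

    fresh-unique : ∀ {p a b} → Fresh p a → Fresh p b → a ≡ b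
    fresh-unique {p} {a} {b} (a∈Sp , a∉N[D]) (b∈Sp , b∉N[D]) with a ≟ b
    ... | yes a≡b = a≡b
    ... | no  a≢b = contradiction ∣D∣<∣D∣ (<-irrefl refl)
      where
      D = Down P p - p
      N[D]⊆ : ⋃[ D ] S ⊆ S p - a - b
      N[D]⊆ c∈ = x∈p∧x≢y⇒x∈p-y (x∈p∧x≢y⇒x∈p-y (⋃[]⊆ (p─q⊆p (Down P p) ⁅ p ⁆) c∈) λ { refl → a∉N[D] c∈ })
                                                                    λ { refl → b∉N[D] c∈ }
      open ≤-Reasoning
      ∣D∣<∣D∣ : 1 + ∣ D ∣ < 1 + ∣ D ∣
      ∣D∣<∣D∣ = begin-strict
        1 + ∣ D ∣                ≤⟨ s≤s (≤-trans (hallS D) (p⊆q⇒∣p∣≤∣q∣ N[D]⊆)) ⟩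
        1 + ∣ S p - a - b ∣      <⟨ s≤s (x∈p⇒∣p-x∣<∣p∣ (x∈p∧x≢y⇒x∈p-y b∈Sp (a≢b ∘ sym))) ⟩
        1 + ∣ S p - a ∣          ≤⟨ x∈p⇒∣p-x∣<∣p∣ a∈Sp ⟩
        ∣ S p ∣                  ≤⟨ bounded p ⟩
        ∣ Down P p ∣             ≤⟨ ∣p∣≤1+∣p-x∣ (Down P p) p ⟩
        1 + ∣ D ∣                ∎

    -- Junk for points outside Union S.
    owner : Fin m → Fin (suc n)
    owner a = proj₁ (argmin (λ p → a ∈? S p) (λ p → ∣ Down P p ∣))

    owner-minimal : ∀ {a x} → a ∈ S x → a ∈ S (owner a) × ∣ Down P (owner a) ∣ ≤ ∣ Down P x ∣
    owner-minimal {a} = proj₂ (argmin (λ p → a ∈? S p) (λ p → ∣ Down P p ∣))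

    owner-fresh : ∀ {a} → a ∈ Union S → Fresh (owner a) a
    owner-fresh a∈U with x∈Union⁻ S a∈U
    ... | x , a∈Sx = proj₁ (owner-minimal a∈Sx) , λ a∈N[D] →
      let w , w∈D , a∈Sw = x∈⋃[]⁻ _ S a∈N[D] in <⇒≱ (∣Down∣-strict w∈D) (proj₂ (owner-minimal a∈Sw))

    owner-injective : ∀ {a b} → a ∈ Union S → b ∈ Union S → owner a ≡ owner b → a ≡ b
    owner-injective a∈U b∈U eq = fresh-unique (owner-fresh a∈U) (subst (λ p → Fresh p _) (sym eq) (owner-fresh b∈U))

    owner-surjective : ∀ p → ∃[ a ] a ∈ Union S × owner a ≡ p
    owner-surjective p = x∈image⁻ owner (Union S) (subst (p ∈_) (sym image≡⊤) ∈⊤)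
      where
      image≡⊤ : image owner (Union S) ≡ ⊤
      image≡⊤ = ∣p∣≡n⇒p≡⊤ (≤-antisym (∣p∣≤n (image owner (Union S)))
        (subst (_≤ ∣ image owner (Union S) ∣) gs (∣p∣≤∣image∣ owner (Union S) owner-injective)))

    fresh : Fin (suc n) → Fin m
    fresh p = proj₁ (owner-surjective p)

    fresh∈Union : ∀ p → fresh p ∈ Union S
    fresh∈Union p = proj₁ (proj₂ (owner-surjective p))

    owner∘fresh : ∀ p → owner (fresh p) ≡ p
    owner∘fresh p = proj₂ (proj₂ (owner-surjective p))

    fresh∘owner : ∀ {a} → a ∈ Union S → fresh (owner a) ≡ a
    fresh∘owner a∈U = owner-injective (fresh∈Union _) a∈U (owner∘fresh _)

    fresh∈S : ∀ p → fresh p ∈ S p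
    fresh∈S p = subst (λ q → fresh p ∈ S q) (owner∘fresh p) (proj₁ (owner-fresh (fresh∈Union p)))

    owner≼⇒∈S : ∀ {a x} → a ∈ Union S → owner a ≼ x → a ∈ S x
    owner≼⇒∈S a∈U owner≼x = mono owner≼x (proj₁ (owner-fresh a∈U))

    fresh-injective : ∀ {v w} → fresh v ≡ fresh w → v ≡ w
    fresh-injective {v} {w} eq = trans (sym (owner∘fresh v)) (trans (cong owner eq) (owner∘fresh w))

    image[fresh]⊆S : ∀ x → image fresh (Down P x) ⊆ S x
    image[fresh]⊆S x = ⋃[]-least (Down P x) (⁅_⁆ ∘ fresh) λ {w} w∈ c∈ →
      subst (_∈ S x) (sym (x∈⁅y⁆⇒x≡y (fresh w) c∈)) (mono (x∈Down⁻ w∈) (fresh∈S w))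

    S⊆image[fresh] : ∀ x → S x ⊆ image fresh (Down P x)
    S⊆image[fresh] x = p⊆q∧∣q∣≤∣p∣⇒q⊆p (image[fresh]⊆S x)
      (≤-trans (bounded x) (∣p∣≤∣image∣ fresh (Down P x) (λ _ _ → fresh-injective)))

    ∈S⇒owner≼ : ∀ {a x} → a ∈ S x → owner a ≼ x
    ∈S⇒owner≼ {a} {x} a∈Sx =
      let w , w∈Down , fresh[w]≡a = x∈image⁻ fresh (Down P x) (S⊆image[fresh] x a∈Sx)
      in subst (_≼ x) (trans (sym (owner∘fresh w)) (cong owner fresh[w]≡a)) (x∈Down⁻ w∈Down)

    isomorphic : Isomorphic S (Down P)
    isomorphic = owner , fresh
               , (λ a _ → x∈Union⁺ (Down P) (x∈Down[x] (owner a)))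
               , (λ p _ → fresh∈Union p)
               , (λ _ a∈U → fresh∘owner a∈U)
               , (λ p _ → owner∘fresh p)
               , λ _ _ a∈U → x∈Down⁺ ∘ ∈S⇒owner≼ , owner≼⇒∈S a∈U ∘ x∈Down⁻

corollary4p4 : (n : ℕ) (P : FinPoset n) → IsIIR P (suc n) →
    (m : ℕ) (S : Family n m) → IsIrreducible P S → groundSize S ≡ suc n →
    Isomorphic S (Down P)
corollary4p4 n P _ m S irreducible gs =
  Canonical.isomorphic P (proj₁ irreducible) hallS (∣S∣≤∣Down∣ hallS) gs
  where
  open Irreducible P irreducible
  hallS = hall gs
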